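{- If a graph $G$ has a $\gamma$-set $D$ such that $\gamma(G-x)>\gamma(G)$ for every $x\in D$, then $\gamma(G)=\gamma_{\rm cer}(G)$.
   Context: All graphs are finite and simple; $G-x$ denotes the graph obtained from $G$ by deleting the vertex $x$. A set $D\subseteq V_G$ is a dominating set of $G$ if every vertex of $V_G-D$ is adjacent to at least one vertex of $D$; $\gamma(G)$ is the minimum cardinality of a dominating set, and a $\gamma$-set is a dominating set of cardinality $\gamma(G)$. A set $D\subseteq V_G$ is a certified dominating set of $G$ if $D$ is a dominating set of $G$ and every vertex in $D$ has either zero or at least two neighbors in $V_G-D$; $\gamma_{\rm cer}(G)$ is the minimum cardinality of a certified dominating set of $G$. -}

module Defs where

open import Data.Nat using (ℕ; zero; suc; _≤_; _<_; pred)
open import Data.Bool using (Bool; true; false)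
open import Data.Fin using (Fin; punchIn)
open import Data.Fin.Subset using (Subset; _∈_; _∉_; ∣_∣; _∩_; ∁)
open import Data.Vec using (tabulate)
open import Data.Product using (Σ; ∃; _×_)
open import Data.Sum using (_⊎_)
open import Relation.Binary.PropositionalEquality using (_≡_)

record Graph (n : ℕ) : Set where
  field
    adj   : Fin n → Fin n → Bool
    sym   : ∀ u v → adj u v ≡ adj v u
    irrefl : ∀ v → adj v v ≡ false
open Graph public

_-ᵥ_ : ∀ {n} → Graph n → Fin n → Graph (pred n)
_-ᵥ_ {suc m} G x = record
  { adj    = λ i j → adj G (punchIn x i) (punchIn x j)
  ; sym    = λ i j → sym G (punchIn x i) (punchIn x j)
  ; irrefl = λ i → irrefl G (punchIn x i)
  }

N : ∀ {n} → Graph n → Fin n → Subset n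
N G v = tabulate (λ u → adj G v u)

IsDominating : ∀ {n} → Graph n → Subset n → Set
IsDominating G D = ∀ v → v ∉ D → ∃ λ u → u ∈ D × adj G u v ≡ true

outDeg : ∀ {n} → Graph n → Subset n → Fin n → ℕ
outDeg G D v = ∣ N G v ∩ ∁ D ∣

IsCertifiedDominating : ∀ {n} → Graph n → Subset n → Set
IsCertifiedDominating G D =
  IsDominating G D × (∀ v → v ∈ D → outDeg G D v ≡ 0 ⊎ 2 ≤ outDeg G D v)

IsMinCard : ∀ {n} → (Subset n → Set) → ℕ → Set
IsMinCard {n} P k = (Σ (Subset n) λ D → P D × ∣ D ∣ ≡ k) × (∀ D → P D → k ≤ ∣ D ∣)

IsDomNumber : ∀ {n} → Graph n → ℕ → Set
IsDomNumber G k = IsMinCard (IsDominating G) k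

IsCerDomNumber : ∀ {n} → Graph n → ℕ → Set
IsCerDomNumber G k = IsMinCard (IsCertifiedDominating G) k

IsGammaSet : ∀ {n} → Graph n → Subset n → Set
IsGammaSet G D = IsDominating G D × (∀ D' → IsDominating G D' → ∣ D ∣ ≤ ∣ D' ∣)

-- If some x ∈ D had exactly one neighbour y outside D, then (D ∪ {y}) − x would
-- dominate G − x: vertices that x dominated are now dominated by y or lie in D.
-- This set has at most ∣D∣ = γ(G) elements, contradicting γ(G − x) > γ(G).
-- Hence every vertex of the γ-set D has 0 or ≥ 2 neighbours outside D, so D is
-- certified, and γ_cer(G) = γ(G) since certified sets are dominating.
module Submission where

open import Defs
open import Data.Nat using (ℕ; _<_)
open import Data.Fin using (Fin)
open import Data.Fin.Subset using (Subset; _∈_; ∣_∣)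

open import Data.Bool using (true)
open import Data.Bool.Properties using () renaming (_≟_ to _≟ᵇ_)
open import Data.Empty using (⊥-elim)
open import Data.Fin using (zero; suc; punchIn; punchOut; _≟_)
open import Data.Fin.Properties using (all?; any?; punchInᵢ≢i; punchOut-punchIn; punchIn-punchOut)
open import Data.Fin.Subset using (_⊆_; _∩_; _∪_; ∁; ⁅_⁆; ⊤; inside; outside)
open import Data.Fin.Subset.Properties
  using (_∈?_; anySubset?; ∈⊤; x∈⁅x⁆; x∈p∩q⁺; x∈p∪q⁺; x∉p⇒x∈∁p; x∈p⇒∣p-x∣<∣p∣; ∪-identityʳ)
open import Data.Nat using (zero; suc; _≤_; _<?_; z≤n; s≤s)
open import Data.Nat.Properties
  using (≤-refl; ≤-trans; ≤-antisym; ≤-pred; ≤-reflexive; <-irrefl; <-≤-trans; ≮⇒≥; n≤0⇒n≡0; n≤1+n)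
open import Data.Product using (∃; _×_; _,_)
open import Data.Sum using (_⊎_; inj₁; inj₂)
open import Data.Vec using (Vec; _∷_; lookup; tabulate; removeAt; here; there)
open import Data.Vec.Properties using (lookup∘tabulate; lookup⇒[]=; []=⇒lookup; removeAt-punchOut)
open import Function using (_∘_)
open import Relation.Nullary using (Dec; yes; no; ¬?; _×-dec_; _→-dec_)
open import Relation.Binary.PropositionalEquality using (_≡_; _≢_; refl; trans; cong; subst) renaming (sym to ≡-sym)

minCard-exists : ∀ {n} {P : Subset n → Set} → (∀ D → Dec (P D)) → ∀ D → P D → ∃ (IsMinCard P)
minCard-exists {P = P} P? D PD = search ∣ D ∣ D PD ≤-refl
  where
  search : ∀ c D → P D → ∣ D ∣ ≤ c → ∃ (IsMinCard P)
  search zero    D PD ∣D∣≤0 = 0 , (D , PD , n≤0⇒n≡0 ∣D∣≤0) , λ _ _ → z≤n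
  search (suc c) D PD ∣D∣≤c with anySubset? (λ E → P? E ×-dec (∣ E ∣ <? ∣ D ∣))
  ... | yes (E , PE , ∣E∣<∣D∣) = search c E PE (≤-pred (≤-trans ∣E∣<∣D∣ ∣D∣≤c))
  ... | no ¬smaller = ∣ D ∣ , (D , PD , refl) , λ E PE → ≮⇒≥ (λ ∣E∣<∣D∣ → ¬smaller (E , PE , ∣E∣<∣D∣))

isDominating? : ∀ {n} (G : Graph n) D → Dec (IsDominating G D)
isDominating? G D = all? λ v → ¬? (v ∈? D) →-dec any? λ u → (u ∈? D) ×-dec (adj G u v ≟ᵇ true)

domNumber-exists : ∀ {n} (G : Graph n) → ∃ (IsDomNumber G)
domNumber-exists G = minCard-exists (isDominating? G) ⊤ (λ v v∉⊤ → ⊥-elim (v∉⊤ ∈⊤))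

isDominating-mono : ∀ {n} (G : Graph n) {D T} → D ⊆ T → IsDominating G D → IsDominating G T
isDominating-mono G D⊆T domD v v∉T with domD v (v∉T ∘ D⊆T)
... | u , u∈D , uv = u , D⊆T u∈D , uv

adj⇒∈N : ∀ {n} (G : Graph n) {u v} → adj G u v ≡ true → v ∈ N G u
adj⇒∈N G {u} {v} uv = lookup⇒[]= v (N G u) (subst (_≡ true) (≡-sym (lookup∘tabulate (adj G u) v)) uv)

∣p∣≡1⇒singleton : ∀ {n} (p : Subset n) → ∣ p ∣ ≡ 1 → ∃ λ y → y ∈ p × (∀ {z} → z ∈ p → z ≡ y)
∣p∣≡1⇒singleton (inside ∷ p) 1+∣p∣≡1 = zero , here , λ
  { here → refl
  ; (there z∈p) → ⊥-elim (<-irrefl (≡-sym 1+∣p∣≡1) (s≤s (≤-trans (s≤s z≤n) (x∈p⇒∣p-x∣<∣p∣ z∈p))))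
  }
∣p∣≡1⇒singleton (outside ∷ p) ∣p∣≡1 with ∣p∣≡1⇒singleton p ∣p∣≡1
... | y , y∈p , unique = suc y , there y∈p , λ { (there z∈p) → cong suc (unique z∈p) }

∣p∪⁅x⁆∣≤1+∣p∣ : ∀ {n} (p : Subset n) x → ∣ p ∪ ⁅ x ⁆ ∣ ≤ suc ∣ p ∣
∣p∪⁅x⁆∣≤1+∣p∣ (inside  ∷ p) zero    rewrite ∪-identityʳ p = s≤s (n≤1+n ∣ p ∣)
∣p∪⁅x⁆∣≤1+∣p∣ (outside ∷ p) zero    rewrite ∪-identityʳ p = ≤-refl
∣p∪⁅x⁆∣≤1+∣p∣ (inside  ∷ p) (suc x) = s≤s (∣p∪⁅x⁆∣≤1+∣p∣ p x)
∣p∪⁅x⁆∣≤1+∣p∣ (outside ∷ p) (suc x) = ∣p∪⁅x⁆∣≤1+∣p∣ p x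

lookup-removeAt : ∀ {a} {A : Set a} {n} (xs : Vec A (suc n)) i j
                → lookup (removeAt xs i) j ≡ lookup xs (punchIn i j)
lookup-removeAt xs i j = subst (λ k → lookup (removeAt xs i) k ≡ lookup xs (punchIn i j))
                               (punchOut-punchIn i) (removeAt-punchOut xs (punchInᵢ≢i i j ∘ ≡-sym))

∈-removeAt : ∀ {m} (p : Subset (suc m)) {i j} → punchIn i j ∈ p → j ∈ removeAt p i
∈-removeAt p {i} {j} ∈p = lookup⇒[]= j (removeAt p i) (trans (lookup-removeAt p i j) ([]=⇒lookup ∈p))

∣removeAt∣ : ∀ {m} (p : Subset (suc m)) {i} → i ∈ p → suc ∣ removeAt p i ∣ ≡ ∣ p ∣
∣removeAt∣ (inside ∷ p)               here        = refl
∣removeAt∣ (inside  ∷ p@(_ ∷ _)) (there i∈p) = cong suc (∣removeAt∣ p i∈p)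
∣removeAt∣ (outside ∷ p@(_ ∷ _)) (there i∈p) = ∣removeAt∣ p i∈p

removeAt-isDominating : ∀ {m} (G : Graph (suc m)) {T} x → IsDominating G T → N G x ⊆ T
                      → IsDominating (G -ᵥ x) (removeAt T x)
removeAt-isDominating G {T} x domT N⊆T v v∉T′ with domT (punchIn x v) (v∉T′ ∘ ∈-removeAt T)
... | u , u∈T , uv with x ≟ u
...   | yes refl = ⊥-elim (v∉T′ (∈-removeAt T (N⊆T (adj⇒∈N G uv))))
...   | no x≢u   = punchOut x≢u
                 , ∈-removeAt T (subst (_∈ T) (≡-sym (punchIn-punchOut x≢u)) u∈T)
                 , subst (λ w → adj G w (punchIn x v) ≡ true) (≡-sym (punchIn-punchOut x≢u)) uv

outDeg≡1⇒γ[G-ᵥx]≤∣D∣ : ∀ {m} (G : Graph (suc m)) {D x} → IsDominating G D → x ∈ D → outDeg G D x ≡ 1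
                     → ∀ {k} → IsDomNumber (G -ᵥ x) k → k ≤ ∣ D ∣
outDeg≡1⇒γ[G-ᵥx]≤∣D∣ G {D} {x} domD x∈D deg≡1 (_ , minimal)
  with ∣p∣≡1⇒singleton (N G x ∩ ∁ D) deg≡1
... | y , _ , unique = ≤-trans (minimal D′ domD′) ∣D′∣≤∣D∣
  where
  T : Subset _
  T = D ∪ ⁅ y ⁆

  D′ : Subset _
  D′ = removeAt T x

  N⊆T : N G x ⊆ T
  N⊆T {v} v∈N with v ∈? D
  ... | yes v∈D = x∈p∪q⁺ (inj₁ v∈D)
  ... | no  v∉D = x∈p∪q⁺ (inj₂ (subst (_∈ ⁅ y ⁆) (≡-sym (unique (x∈p∩q⁺ (v∈N , x∉p⇒x∈∁p v∉D)))) (x∈⁅x⁆ y)))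

  domD′ : IsDominating (G -ᵥ x) D′
  domD′ = removeAt-isDominating G x (isDominating-mono G (x∈p∪q⁺ ∘ inj₁) domD) N⊆T

  ∣D′∣≤∣D∣ : ∣ D′ ∣ ≤ ∣ D ∣
  ∣D′∣≤∣D∣ = ≤-pred (subst (_≤ suc ∣ D ∣) (≡-sym (∣removeAt∣ T (x∈p∪q⁺ (inj₁ x∈D)))) (∣p∪⁅x⁆∣≤1+∣p∣ D y))

n≢1⇒n≡0⊎2≤n : ∀ {n} → n ≢ 1 → n ≡ 0 ⊎ 2 ≤ n
n≢1⇒n≡0⊎2≤n {zero}        _   = inj₁ refl
n≢1⇒n≡0⊎2≤n {suc zero}    n≢1 = ⊥-elim (n≢1 refl)
n≢1⇒n≡0⊎2≤n {suc (suc n)} _   = inj₂ (s≤s (s≤s z≤n))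

certifies-if-deletion-raises-γ : ∀ {n} (G : Graph n) {D γ} → IsDominating G D → ∣ D ∣ ≤ γ
  → (∀ x → x ∈ D → ∀ k → IsDomNumber (G -ᵥ x) k → γ < k)
  → ∀ x → x ∈ D → outDeg G D x ≡ 0 ⊎ 2 ≤ outDeg G D x
certifies-if-deletion-raises-γ {zero} G domD ∣D∣≤γ raises ()
certifies-if-deletion-raises-γ {suc m} G domD ∣D∣≤γ raises x x∈D = n≢1⇒n≡0⊎2≤n λ deg≡1 →
  let k , γ[G-ᵥx]≡k = domNumber-exists (G -ᵥ x)
  in <-irrefl refl (<-≤-trans (raises x x∈D k γ[G-ᵥx]≡k)
                              (≤-trans (outDeg≡1⇒γ[G-ᵥx]≤∣D∣ G domD x∈D deg≡1 γ[G-ᵥx]≡k) ∣D∣≤γ))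

corollary2p5 : ∀ {n} (G : Graph n) (D : Subset n) (γ : ℕ)
    → IsDomNumber G γ
    → IsGammaSet G D
    → (∀ x → x ∈ D → ∀ k → IsDomNumber (G -ᵥ x) k → γ < k)
    → IsCerDomNumber G γ
corollary2p5 G D γ ((D₀ , domD₀ , ∣D₀∣≡γ) , γ-minimal) (domD , D-minimal) raises =
  (D , (domD , certifies-if-deletion-raises-γ G domD (≤-reflexive ∣D∣≡γ) raises) , ∣D∣≡γ)
  , λ D′ (domD′ , _) → γ-minimal D′ domD′
  where
  ∣D∣≡γ : ∣ D ∣ ≡ γ
  ∣D∣≡γ = ≤-antisym (subst (∣ D ∣ ≤_) ∣D₀∣≡γ (D-minimal D₀ domD₀)) (γ-minimal D domD)
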